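{- For all trees $T,T'$ (of the same size), $T\le_{\mathcal T}T'$ implies $\langle T\rangle\le^{\mathrm{Lex}}\langle T'\rangle$.
   Context: Trees: finite binary rooted trees; $\bullet$ is the one-leaf tree and $T_0\wedge T_1$ the tree with left subtree $T_0$ and right subtree $T_1$. A left rotation replaces some subtree of the form $T_0\wedge(T_1\wedge T_2)$ by $(T_0\wedge T_1)\wedge T_2$; $T\le_{\mathcal T}T'$ means $T'$ is obtained from $T$ by finitely many (possibly zero) left rotations. The (right) Polish encoding $\langle T\rangle$ is the word over $\{\bullet,\circ\}$ defined by $\langle\bullet\rangle=\bullet$ and $\langle T_0\wedge T_1\rangle=\langle T_0\rangle\langle T_1\rangle\circ$. $\le^{\mathrm{Lex}}$ is the lexicographic extension of the order $\bullet<\circ$ to words over $\{\bullet,\circ\}$. -}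

module Defs where

open import Data.List using (List; []; _∷_; _++_; [_])
open import Relation.Binary.PropositionalEquality using (_≡_)
open import Relation.Binary.Construct.Closure.ReflexiveTransitive using (Star)

data Tree : Set where
  •   : Tree
  _∧_ : Tree → Tree → Tree

infixr 5 _∧_

data LeftRot : Tree → Tree → Set where
  rot   : ∀ T₀ T₁ T₂ → LeftRot (T₀ ∧ (T₁ ∧ T₂)) ((T₀ ∧ T₁) ∧ T₂)
  left  : ∀ {T T'} S → LeftRot T T' → LeftRot (T ∧ S) (T' ∧ S)
  right : ∀ {T T'} S → LeftRot T T' → LeftRot (S ∧ T) (S ∧ T')

_≤T_ : Tree → Tree → Set
_≤T_ = Star LeftRot

data Letter : Set where
  b : Letter   -- the letter •
  c : Letter   -- the letter ∘

data _<L_ : Letter → Letter → Set where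
  b<c : b <L c

⟨_⟩ : Tree → List Letter
⟨ • ⟩ = b ∷ []
⟨ T₀ ∧ T₁ ⟩ = ⟨ T₀ ⟩ ++ ⟨ T₁ ⟩ ++ (c ∷ [])

-- lexicographic (non-strict) extension of • < ∘ to words;
-- a proper prefix is smaller
data _≤Lex_ : List Letter → List Letter → Set where
  []≤   : ∀ {w} → [] ≤Lex w
  same  : ∀ {x u v} → u ≤Lex v → (x ∷ u) ≤Lex (x ∷ v)
  less  : ∀ {x y u v} → x <L y → (x ∷ u) ≤Lex (y ∷ v)

module Submission where

-- Since ≤Lex lets a proper prefix be smaller, it is not compatible with
-- appending different suffixes; we therefore work with the strict
-- "first difference" order u <Diff v: at the first position where u and v
-- differ, u has • and v has ∘.  This order is transitive and is preserved
-- by adding a common prefix and by appending arbitrary suffixes.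
--
-- A single rotation T₀ ∧ (T₁ ∧ T₂) ↦ (T₀ ∧ T₁) ∧ T₂ changes the encoding
-- from ⟨T₀⟩⟨T₁⟩⟨T₂⟩∘∘ to ⟨T₀⟩⟨T₁⟩∘⟨T₂⟩∘; after the common prefix the first
-- word continues with ⟨T₂⟩, which begins with •, and the second with ∘.
-- Rotating inside a subtree only changes an infix of the encoding, so every
-- LeftRot step is <Diff-increasing, and by transitivity so is every
-- non-empty rotation sequence.  Finally <Diff implies ≤Lex, and the empty
-- sequence is handled by reflexivity of ≤Lex.

open import Defs
open import Data.List using (List; []; _∷_; _++_)
open import Data.List.Properties using (++-assoc)
open import Data.Product using (∃; _,_)
open import Relation.Binary.PropositionalEquality using (_≡_; refl; sym; cong; subst₂; module ≡-Reasoning)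
open import Relation.Binary.Construct.Closure.ReflexiveTransitive using (Star; ε; _◅_)

data _<Diff_ : List Letter → List Letter → Set where
  here  : ∀ {x y u v} → x <L y → (x ∷ u) <Diff (y ∷ v)
  there : ∀ {x u v} → u <Diff v → (x ∷ u) <Diff (x ∷ v)

<Diff-trans : ∀ {u v w} → u <Diff v → v <Diff w → u <Diff w
<Diff-trans (here b<c) (here ())
<Diff-trans (here x<y) (there _)   = here x<y
<Diff-trans (there _)  (here y<z)  = here y<z
<Diff-trans (there p)  (there q)   = there (<Diff-trans p q)

<Diff-++ : ∀ {u v} w w' → u <Diff v → (u ++ w) <Diff (v ++ w')
<Diff-++ w w' (here x<y) = here x<y
<Diff-++ w w' (there p)  = there (<Diff-++ w w' p)

++-<Diff : ∀ p {u v} → u <Diff v → (p ++ u) <Diff (p ++ v)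
++-<Diff []      q = q
++-<Diff (x ∷ p) q = there (++-<Diff p q)

<Diff⇒≤Lex : ∀ {u v} → u <Diff v → u ≤Lex v
<Diff⇒≤Lex (here x<y) = less x<y
<Diff⇒≤Lex (there p)  = same (<Diff⇒≤Lex p)

≤Lex-refl : ∀ u → u ≤Lex u
≤Lex-refl []      = []≤
≤Lex-refl (x ∷ u) = same (≤Lex-refl u)

encoding-starts-with-• : ∀ T → ∃ λ r → ⟨ T ⟩ ≡ b ∷ r
encoding-starts-with-• • = [] , refl
encoding-starts-with-• (T₀ ∧ T₁) with encoding-starts-with-• T₀
... | r , eq rewrite eq = r ++ ⟨ T₁ ⟩ ++ c ∷ [] , refl

encoding<Diff∘ : ∀ T w v → (⟨ T ⟩ ++ w) <Diff (c ∷ v)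
encoding<Diff∘ T w v with encoding-starts-with-• T
... | r , eq rewrite eq = here b<c

rotation-increases : ∀ T₀ T₁ T₂ → ⟨ T₀ ∧ (T₁ ∧ T₂) ⟩ <Diff ⟨ (T₀ ∧ T₁) ∧ T₂ ⟩
rotation-increases T₀ T₁ T₂ =
  subst₂ _<Diff_ before after
    (++-<Diff A (++-<Diff B (encoding<Diff∘ T₂ (c ∷ c ∷ []) (C ++ c ∷ []))))
  where
  open ≡-Reasoning
  A = ⟨ T₀ ⟩
  B = ⟨ T₁ ⟩
  C = ⟨ T₂ ⟩

  before : A ++ B ++ C ++ c ∷ c ∷ [] ≡ A ++ (B ++ C ++ c ∷ []) ++ c ∷ []
  before = cong (A ++_) (begin
    B ++ C ++ c ∷ c ∷ []          ≡⟨ cong (B ++_) (sym (++-assoc C (c ∷ []) (c ∷ []))) ⟩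
    B ++ (C ++ c ∷ []) ++ c ∷ []  ≡⟨ sym (++-assoc B (C ++ c ∷ []) (c ∷ [])) ⟩
    (B ++ C ++ c ∷ []) ++ c ∷ []  ∎)

  after : A ++ B ++ c ∷ C ++ c ∷ [] ≡ (A ++ B ++ c ∷ []) ++ C ++ c ∷ []
  after = begin
    A ++ B ++ c ∷ C ++ c ∷ []        ≡⟨ cong (A ++_) (sym (++-assoc B (c ∷ []) (C ++ c ∷ []))) ⟩
    A ++ (B ++ c ∷ []) ++ C ++ c ∷ []  ≡⟨ sym (++-assoc A (B ++ c ∷ []) (C ++ c ∷ [])) ⟩
    (A ++ B ++ c ∷ []) ++ C ++ c ∷ []  ∎

left-rotation-increases : ∀ {T T'} → LeftRot T T' → ⟨ T ⟩ <Diff ⟨ T' ⟩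
left-rotation-increases (rot T₀ T₁ T₂) = rotation-increases T₀ T₁ T₂
left-rotation-increases (left S r) =
  <Diff-++ (⟨ S ⟩ ++ c ∷ []) (⟨ S ⟩ ++ c ∷ []) (left-rotation-increases r)
left-rotation-increases (right S r) =
  ++-<Diff ⟨ S ⟩ (<Diff-++ (c ∷ []) (c ∷ []) (left-rotation-increases r))

rotations-increase : ∀ {T T' T''} → LeftRot T T' → T' ≤T T'' → ⟨ T ⟩ <Diff ⟨ T'' ⟩
rotations-increase r ε         = left-rotation-increases r
rotations-increase r (r' ◅ rs) =
  <Diff-trans (left-rotation-increases r) (rotations-increase r' rs)

lemma4p1 : ∀ (T T' : Tree) → T ≤T T' → ⟨ T ⟩ ≤Lex ⟨ T' ⟩
lemma4p1 T .T ε        = ≤Lex-refl ⟨ T ⟩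
lemma4p1 T T' (r ◅ rs) = <Diff⇒≤Lex (rotations-increase r rs)
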